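{- Let $k\ge 0$, let $R=R_k$, let $G=\{g_1,\dots,g_p\}$ be a finite group of odd order $p$, let $v_1,v_2\in RG$ and $\gamma_1,\gamma_2,\gamma_3,\gamma_4\in R$. Suppose $\gamma_2+\gamma_4$ is a unit in $R_k$ and that the code $C_\sigma$ (defined in the context) is self-dual. Then $v_1^*v_1+v_2^*v_2$ is a non-unit in $RG$.
   Context: $R_0=\mathbb{F}_2$ and, for $k\ge1$, $R_k=\mathbb{F}_2[u_1,\dots,u_k]/\langle u_i^2,\ u_iu_j-u_ju_i\rangle$, a finite commutative Frobenius ring of characteristic $2$. For $G=\{g_1,\dots,g_p\}$ (elements listed in a fixed order) and $v=\sum_{g\in G}\alpha_g g\in RG$, $\sigma(v)$ denotes the $p\times p$ matrix with $(i,j)$ entry $\alpha_{g_i^{ -1}g_j}$, and $v^*=\sum_g\alpha_g g^{ -1}$ is the canonical involution. Define the $(p+1)\times(p+1)$ matrices $A$ and $B$: $A$ has first row $(\gamma_1,\gamma_2,\dots,\gamma_2)$, first column $(\gamma_1,\gamma_2,\dots,\gamma_2)^T$, and lower-right $p\times p$ block $\sigma(v_1)$; $B$ has first row $(\gamma_3,\gamma_4,\dots,\gamma_4)$, first column $(\gamma_3,\gamma_4,\dots,\gamma_4)^T$, and lower-right block $\sigma(v_2)$. $C_\sigma$ is the code over $R$ of length $4p+4$ generated by the $(2p+2)\times(4p+4)$ matrix $\left[\, I_{2p+2} \;\middle|\; \begin{matrix} A & B\\ B^T & A^T\end{matrix}\,\right]$. A code $C$ is self-dual if $C=C^\perp$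 with respect to the standard inner product $\sum_i v_iw_i$. -}

module Defs where

open import Data.Bool using (Bool; true; false; _xor_; _∧_; if_then_else_)
open import Data.Nat using (ℕ; zero; suc; _+_)
open import Data.Fin using (Fin; zero; suc; splitAt; _≟_)
open import Data.Sum using (inj₁; inj₂)
open import Data.Product using (_×_; _,_; Σ; ∃)
open import Relation.Nullary using (does)
open import Relation.Binary.PropositionalEquality using (_≡_)
open import Algebra.Structures using (IsGroup)
open import Function.Bundles using (_⇔_)

-- The rings R_k = F_2[u_1,…,u_k]/⟨u_i^2, u_iu_j - u_ju_i⟩.
-- Built recursively: R_0 = F_2 (= Bool with xor / and),
-- R_{k+1} = R_k[u_{k+1}]/⟨u_{k+1}^2⟩, an element (a , b) standing for a + b·u_{k+1}.

R : ℕ → Set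
R zero    = Bool
R (suc k) = R k × R k

0R : ∀ k → R k
0R zero    = false
0R (suc k) = 0R k , 0R k

1R : ∀ k → R k
1R zero    = true
1R (suc k) = 1R k , 0R k

infixl 6 _+R_
infixl 7 _*R_

_+R_ : ∀ {k} → R k → R k → R k
_+R_ {zero}  a b = a xor b
_+R_ {suc k} (a , b) (c , d) = (a +R c) , (b +R d)

-- (a + b u)(c + d u) = ac + (ad + bc) u   since u^2 = 0
_*R_ : ∀ {k} → R k → R k → R k
_*R_ {zero}  a b = a ∧ b
_*R_ {suc k} (a , b) (c , d) = (a *R c) , ((a *R d) +R (b *R c))

IsUnitR : ∀ {k} → R k → Set
IsUnitR {k} x = Σ (R k) λ y → x *R y ≡ 1R k

ΣR : ∀ {k n} → (Fin n → R k) → R k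
ΣR {k} {zero}  f = 0R k
ΣR {k} {suc n} f = f zero +R ΣR (λ i → f (suc i))

-- A finite group G = {g_1,…,g_p}: a group structure on Fin p; the fixed
-- listing g_1,…,g_p is the natural order of Fin p.

record FinGroup (p : ℕ) : Set where
  field
    _·_     : Fin p → Fin p → Fin p
    e       : Fin p
    inv     : Fin p → Fin p
    isGroup : IsGroup _≡_ _·_ e inv

RG : ℕ → ℕ → Set
RG k p = Fin p → R k

module GroupRing {k p : ℕ} (G : FinGroup p) where
  open FinGroup G

  star : RG k p → RG k p
  star v g = v (inv g)

  addRG : RG k p → RG k p → RG k p
  addRG v w g = v g +R w g

  mulRG : RG k p → RG k p → RG k p
  mulRG v w g = ΣR (λ h → v h *R w (inv h · g))

  oneRG : RG k p
  oneRG g = if does (g ≟ e) then 1R k else 0R k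

  IsUnitRG : RG k p → Set
  IsUnitRG v = Σ (RG k p) λ w →
    ((g : Fin p) → mulRG v w g ≡ oneRG g) × ((g : Fin p) → mulRG w v g ≡ oneRG g)

  σ : RG k p → Fin p → Fin p → R k
  σ v i j = v (inv i · j)

  bordered : R k → R k → RG k p → Fin (suc p) → Fin (suc p) → R k
  bordered a b v zero    zero    = a
  bordered a b v zero    (suc j) = b
  bordered a b v (suc i) zero    = b
  bordered a b v (suc i) (suc j) = σ v i j

  transpose : ∀ {m n} → (Fin m → Fin n → R k) → Fin n → Fin m → R k
  transpose M i j = M j i

  block : ∀ {n} → (Fin n → Fin n → R k) → (Fin n → Fin n → R k) →
          Fin (n + n) → Fin (n + n) → R k
  block {n} A B i j with splitAt n i | splitAt n j
  ... | inj₁ i' | inj₁ j' = A i' j'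
  ... | inj₁ i' | inj₂ j' = B i' j'
  ... | inj₂ i' | inj₁ j' = transpose B i' j'
  ... | inj₂ i' | inj₂ j' = transpose A i' j'

  identity : ∀ {n} → Fin n → Fin n → R k
  identity i j = if does (i ≟ j) then 1R k else 0R k

  augment : ∀ {n} → (Fin n → Fin n → R k) → Fin n → Fin (n + n) → R k
  augment {n} M i j with splitAt n j
  ... | inj₁ j' = identity i j'
  ... | inj₂ j' = M i j'

  genCσ : RG k p → RG k p → R k → R k → R k → R k →
          Fin (suc p + suc p) → Fin ((suc p + suc p) + (suc p + suc p)) → R k
  genCσ v₁ v₂ γ₁ γ₂ γ₃ γ₄ =
    augment (block (bordered γ₁ γ₂ v₁) (bordered γ₃ γ₄ v₂))

dot : ∀ {k n} → (Fin n → R k) → (Fin n → R k) → R k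
dot x y = ΣR (λ i → x i *R y i)

InCode : ∀ {k m n} → (Fin m → Fin n → R k) → (Fin n → R k) → Set
InCode {k} {m} {n} M x =
  Σ (Fin m → R k) λ a → (j : Fin n) → x j ≡ ΣR (λ i → a i *R M i j)

InDual : ∀ {k m n} → (Fin m → Fin n → R k) → (Fin n → R k) → Set
InDual {k} {m} {n} M x = (c : Fin n → R k) → InCode M c → dot c x ≡ 0R k

SelfDual : ∀ {k m n} → (Fin m → Fin n → R k) → Set
SelfDual {k} {m} {n} M = (x : Fin n → R k) → InCode M x ⇔ InDual M x

-- The theorem is proved by reducing everything to 𝔽₂ = R_k/𝔪, where 𝔪 = ⟨u_1,…,u_k⟩
-- is the maximal ideal of R_k.
--
--  * The residue map π : R_k → 𝔽₂ is a ring homomorphism, and composing it with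
--    the augmentation RG → R gives a ring homomorphism ε̄ : RG → 𝔽₂ fixed by the
--    involution *.  Homomorphisms send units to units, so π(γ₂+γ₄) = 1, and if
--    x = v₁*v₁ + v₂*v₂ were a unit then 1 = ε̄(x) = ε̄(v₁)² + ε̄(v₂)² = ε̄(v₁) + ε̄(v₂).
--  * In a self-dual code every generator row r is self-orthogonal, r·r = 0.  Over
--    𝔽₂ squaring is the identity, so π(r·r) is the sum of the residues of the
--    entries of r.  For the row of [I | A B; Bᵀ Aᵀ] passing through a group row of
--    A this sum is 1 + (π γ₂ + ε̄ v₁) + (π γ₄ + ε̄ v₂), hence
--    π γ₂ + π γ₄ + ε̄ v₁ + ε̄ v₂ = 1 in 𝔽₂.
--  * Both bullets together give 1 + 1 = 1 in 𝔽₂, a contradiction.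
module Submission where

open import Defs
open import Data.Nat using (ℕ; _%_; zero; suc; _+_)
open import Data.Bool using (Bool; true; false; _xor_; _∧_; if_then_else_)
open import Data.Bool.Properties using (xor-∧-commutativeRing; ∧-idem; ∧-conicalˡ)
open import Data.Fin using (Fin; zero; suc; _≟_; _↑ˡ_; _↑ʳ_)
open import Data.Fin.Properties using (splitAt-↑ˡ; splitAt-↑ʳ)
open import Data.Product using (_,_)
open import Relation.Nullary using (¬_; does)
open import Relation.Binary.PropositionalEquality
  using (_≡_; _≢_; refl; sym; trans; cong; cong₂; module ≡-Reasoning)
open import Function.Bundles using (Equivalence)
open import Algebra.Bundles using (CommutativeRing; Group)
open import Algebra.Structures using (IsGroup)
import Data.Fin.Permutation as Perm
import Algebra.Properties.Group as GroupProperties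
import Algebra.Properties.CommutativeSemigroup as CommutativeSemigroupProperties

module 𝔽₂ = CommutativeRing xor-∧-commutativeRing
open import Algebra.Properties.CommutativeMonoid.Sum 𝔽₂.+-commutativeMonoid
  using (sum; sum-permute; ∑-comm; sum-cong-≗; ∑-distrib-+; sum-replicate-zero)
import Algebra.Properties.Semiring.Sum 𝔽₂.semiring as 𝔽₂Sum
open CommutativeSemigroupProperties 𝔽₂.+-commutativeSemigroup using (interchange)

open ≡-Reasoning

+R-identityˡ : ∀ {k} (x : R k) → 0R k +R x ≡ x
+R-identityˡ {zero}  x       = refl
+R-identityˡ {suc k} (a , b) = cong₂ _,_ (+R-identityˡ a) (+R-identityˡ b)

+R-identityʳ : ∀ {k} (x : R k) → x +R 0R k ≡ x
+R-identityʳ {zero}  false   = refl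
+R-identityʳ {zero}  true    = refl
+R-identityʳ {suc k} (a , b) = cong₂ _,_ (+R-identityʳ a) (+R-identityʳ b)

*R-zeroˡ : ∀ {k} (x : R k) → 0R k *R x ≡ 0R k
*R-zeroˡ {zero}  x       = refl
*R-zeroˡ {suc k} (a , b) =
  cong₂ _,_ (*R-zeroˡ a)
            (trans (cong₂ _+R_ (*R-zeroˡ b) (*R-zeroˡ a)) (+R-identityˡ (0R k)))

*R-identityˡ : ∀ {k} (x : R k) → 1R k *R x ≡ x
*R-identityˡ {zero}  x       = refl
*R-identityˡ {suc k} (a , b) =
  cong₂ _,_ (*R-identityˡ a)
            (trans (cong₂ _+R_ (*R-identityˡ b) (*R-zeroˡ a)) (+R-identityʳ b))

ΣR-cong : ∀ {k n} {f g : Fin n → R k} → (∀ i → f i ≡ g i) → ΣR f ≡ ΣR g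
ΣR-cong {n = zero}  f≗g = refl
ΣR-cong {n = suc n} f≗g = cong₂ _+R_ (f≗g zero) (ΣR-cong (λ i → f≗g (suc i)))

ΣR-zero : ∀ {k n} (f : Fin n → R k) → (∀ i → f i ≡ 0R k) → ΣR f ≡ 0R k
ΣR-zero {k} {zero}  f f≗0 = refl
ΣR-zero {k} {suc n} f f≗0 =
  trans (cong₂ _+R_ (f≗0 zero) (ΣR-zero _ (λ i → f≗0 (suc i)))) (+R-identityˡ (0R k))

δR : ∀ {k n} → Fin n → Fin n → R k
δR {k} r i = if does (r ≟ i) then 1R k else 0R k

ΣR-δ : ∀ {k n} (f : Fin n → R k) (r : Fin n) → ΣR (λ i → δR r i *R f i) ≡ f r
ΣR-δ {k} {suc n} f zero = begin
  1R k *R f zero +R ΣR (λ i → 0R k *R f (suc i))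
    ≡⟨ cong₂ _+R_ (*R-identityˡ (f zero)) (ΣR-zero _ (λ i → *R-zeroˡ (f (suc i)))) ⟩
  f zero +R 0R k
    ≡⟨ +R-identityʳ (f zero) ⟩
  f zero ∎
ΣR-δ {k} {suc n} f (suc r) =
  trans (drop-zeroˡ (*R-zeroˡ (f zero))) (ΣR-δ (λ i → f (suc i)) r)
  where
  drop-zeroˡ : ∀ {x y : R k} → x ≡ 0R k → x +R y ≡ y
  drop-zeroˡ {y = y} x≡0 = trans (cong (_+R y) x≡0) (+R-identityˡ y)

π : ∀ {k} → R k → Bool
π {zero}  a       = a
π {suc k} (a , b) = π a

π-+ : ∀ {k} (x y : R k) → π (x +R y) ≡ π x xor π y
π-+ {zero}  x       y       = refl
π-+ {suc k} (a , b) (c , d) = π-+ a c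

π-* : ∀ {k} (x y : R k) → π (x *R y) ≡ π x ∧ π y
π-* {zero}  x       y       = refl
π-* {suc k} (a , b) (c , d) = π-* a c

π-0 : ∀ k → π (0R k) ≡ false
π-0 zero    = refl
π-0 (suc k) = π-0 k

π-1 : ∀ k → π (1R k) ≡ true
π-1 zero    = refl
π-1 (suc k) = π-1 k

π-if : ∀ k (b : Bool) → π (if b then 1R k else 0R k) ≡ b
π-if k true  = π-1 k
π-if k false = π-0 k

π-Σ : ∀ {k n} (f : Fin n → R k) → π (ΣR f) ≡ sum (λ i → π (f i))
π-Σ {k} {zero}  f = π-0 k
π-Σ {k} {suc n} f =
  trans (π-+ (f zero) (ΣR (λ i → f (suc i)))) (cong (π (f zero) xor_) (π-Σ (λ i → f (suc i))))

-- A unit of R_k has residue 1, since its image is a unit of 𝔽₂.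
π-unit : ∀ {k} {x : R k} → IsUnitR x → π x ≡ true
π-unit {k} {x} (y , xy≡1) =
  ∧-conicalˡ (π x) (π y) (trans (sym (π-* x y)) (trans (cong π xy≡1) (π-1 k)))

sum-++ : ∀ m n (f : Fin (m + n) → Bool) →
         sum f ≡ sum (λ i → f (i ↑ˡ n)) xor sum (λ i → f (m ↑ʳ i))
sum-++ zero    n f = refl
sum-++ (suc m) n f =
  trans (cong (f zero xor_) (sum-++ m n (λ i → f (suc i)))) (sym (𝔽₂.+-assoc (f zero) _ _))

sum-δ-row : ∀ {n} (r : Fin n) → sum (λ j → does (r ≟ j)) ≡ true
sum-δ-row {suc n} zero    = cong (true xor_) (sum-replicate-zero n)
sum-δ-row {suc n} (suc r) = sum-δ-row r

sum-δ-column : ∀ {n} (c : Fin n) → sum (λ i → does (i ≟ c)) ≡ true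
sum-δ-column {suc n} zero    = cong (true xor_) (sum-replicate-zero n)
sum-δ-column {suc n} (suc c) = sum-δ-column c

rowSum : ∀ {k m n} → (Fin m → Fin n → R k) → Fin m → Bool
rowSum M r = sum (λ j → π (M r j))

-- Every row of a generator matrix is a codeword (take the r-th unit coefficient vector).
row-inCode : ∀ {k m n} (M : Fin m → Fin n → R k) (r : Fin m) → InCode M (M r)
row-inCode M r = (λ i → δR r i) , (λ j → sym (ΣR-δ (λ i → M i j) r))

selfDual-row-orthogonal : ∀ {k m n} (M : Fin m → Fin n → R k) → SelfDual M →
                          (r : Fin m) → dot (M r) (M r) ≡ 0R k
selfDual-row-orthogonal M selfDual r =
  Equivalence.to (selfDual (M r)) (row-inCode M r) (M r) (row-inCode M r)

-- Modulo 𝔪, x·x is the sum of the entries of x, because squaring is trivial on 𝔽₂.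
π-dot-self : ∀ {k n} (x : Fin n → R k) → π (dot x x) ≡ sum (λ j → π (x j))
π-dot-self x =
  trans (π-Σ (λ j → x j *R x j))
        (sum-cong-≗ (λ j → trans (π-* (x j) (x j)) (∧-idem (π (x j)))))

selfDual-rowSum : ∀ {k m n} (M : Fin m → Fin n → R k) → SelfDual M →
                  (r : Fin m) → rowSum M r ≡ false
selfDual-rowSum {k} M selfDual r = begin
  rowSum M r             ≡⟨ sym (π-dot-self (M r)) ⟩
  π (dot (M r) (M r))    ≡⟨ cong π (selfDual-row-orthogonal M selfDual r) ⟩
  π (0R k)               ≡⟨ π-0 k ⟩
  false                  ∎

module _ {k p : ℕ} (G : FinGroup p) where
  open FinGroup G
  open GroupRing {k} {p} G
  open IsGroup isGroup using (assoc; identityˡ; inverseˡ; inverseʳ)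

  asGroup : Group _ _
  asGroup = record { isGroup = isGroup }

  open GroupProperties asGroup using (⁻¹-involutive)

  sum-translate : (h : Fin p) (f : Fin p → Bool) → sum (λ j → f (h · j)) ≡ sum f
  sum-translate h f = sym (sum-permute f (Perm.permutation (h ·_) (inv h ·_) cancel cancel′))
    where
    cancel : ∀ y → h · (inv h · y) ≡ y
    cancel y = trans (sym (assoc h (inv h) y)) (trans (cong (_· y) (inverseʳ h)) (identityˡ y))
    cancel′ : ∀ y → inv h · (h · y) ≡ y
    cancel′ y = trans (sym (assoc (inv h) h y)) (trans (cong (_· y) (inverseˡ h)) (identityˡ y))

  sum-invert : (f : Fin p → Bool) → sum (λ j → f (inv j)) ≡ sum f
  sum-invert f = sym (sum-permute f (Perm.permutation inv inv ⁻¹-involutive ⁻¹-involutive))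

  ε̄ : RG k p → Bool
  ε̄ v = sum (λ g → π (v g))

  ε̄-star : ∀ v → ε̄ (star v) ≡ ε̄ v
  ε̄-star v = sum-invert (λ g → π (v g))

  ε̄-add : ∀ v w → ε̄ (addRG v w) ≡ ε̄ v xor ε̄ w
  ε̄-add v w =
    trans (sum-cong-≗ (λ g → π-+ (v g) (w g))) (∑-distrib-+ (λ g → π (v g)) (λ g → π (w g)))

  ε̄-one : ε̄ oneRG ≡ true
  ε̄-one = trans (sum-cong-≗ (λ g → π-if k (does (g ≟ e)))) (sum-δ-column e)

  ε̄-mul : ∀ v w → ε̄ (mulRG v w) ≡ ε̄ v ∧ ε̄ w
  ε̄-mul v w = begin
    sum (λ g → π (mulRG v w g))
      ≡⟨ sum-cong-≗ (λ g → trans (π-Σ (λ h → v h *R w (inv h · g)))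
                                 (sum-cong-≗ (λ h → π-* (v h) (w (inv h · g))))) ⟩
    sum (λ g → sum (λ h → π (v h) ∧ π (w (inv h · g))))
      ≡⟨ ∑-comm (λ g h → π (v h) ∧ π (w (inv h · g))) ⟩
    sum (λ h → sum (λ g → π (v h) ∧ π (w (inv h · g))))
      ≡⟨ sum-cong-≗ (λ h → sym (𝔽₂Sum.*-distribˡ-sum (π (v h)) (λ g → π (w (inv h · g))))) ⟩
    sum (λ h → π (v h) ∧ sum (λ g → π (w (inv h · g))))
      ≡⟨ sum-cong-≗ (λ h → cong (π (v h) ∧_) (sum-translate (inv h) (λ g → π (w g)))) ⟩
    sum (λ h → π (v h) ∧ ε̄ w)
      ≡⟨ sym (𝔽₂Sum.*-distribʳ-sum (ε̄ w) (λ h → π (v h))) ⟩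
    ε̄ v ∧ ε̄ w ∎

  ε̄-norm : ∀ v → ε̄ (mulRG (star v) v) ≡ ε̄ v
  ε̄-norm v = trans (ε̄-mul (star v) v) (trans (cong (_∧ ε̄ v) (ε̄-star v)) (∧-idem (ε̄ v)))

  ε̄-unit : ∀ {x} → IsUnitRG x → ε̄ x ≡ true
  ε̄-unit {x} (w , xw≡1 , _) =
    ∧-conicalˡ (ε̄ x) (ε̄ w)
      (trans (sym (ε̄-mul x w)) (trans (sum-cong-≗ (λ g → cong π (xw≡1 g))) ε̄-one))

  augment-rowSum : ∀ {n} (M : Fin n → Fin n → R k) (r : Fin n) →
                   rowSum (augment M) r ≡ true xor rowSum M r
  augment-rowSum {n} M r = begin
    rowSum (augment M) r
      ≡⟨ sum-++ n n (λ j → π (augment M r j)) ⟩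
    sum (λ j → π (augment M r (j ↑ˡ n))) xor sum (λ j → π (augment M r (n ↑ʳ j)))
      ≡⟨ cong₂ _xor_ (sum-cong-≗ identityPart) (sum-cong-≗ matrixPart) ⟩
    sum (λ j → does (r ≟ j)) xor rowSum M r
      ≡⟨ cong (_xor rowSum M r) (sum-δ-row r) ⟩
    true xor rowSum M r ∎
    where
    identityPart : ∀ j → π (augment M r (j ↑ˡ n)) ≡ does (r ≟ j)
    identityPart j rewrite splitAt-↑ˡ n j n = π-if k (does (r ≟ j))
    matrixPart : ∀ j → π (augment M r (n ↑ʳ j)) ≡ π (M r j)
    matrixPart j rewrite splitAt-↑ʳ n n j = refl

  block-rowSum : ∀ {n} (A B : Fin n → Fin n → R k) (i : Fin n) →
                 rowSum (block A B) (i ↑ˡ n) ≡ rowSum A i xor rowSum B i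
  block-rowSum {n} A B i =
    trans (sum-++ n n (λ j → π (block A B (i ↑ˡ n) j)))
          (cong₂ _xor_ (sum-cong-≗ leftPart) (sum-cong-≗ rightPart))
    where
    leftPart : ∀ j → π (block A B (i ↑ˡ n) (j ↑ˡ n)) ≡ π (A i j)
    leftPart j rewrite splitAt-↑ˡ n i n | splitAt-↑ˡ n j n = refl
    rightPart : ∀ j → π (block A B (i ↑ˡ n) (n ↑ʳ j)) ≡ π (B i j)
    rightPart j rewrite splitAt-↑ˡ n i n | splitAt-↑ʳ n n j = refl

  bordered-rowSum : ∀ a b v (i : Fin p) → rowSum (bordered a b v) (suc i) ≡ π b xor ε̄ v
  bordered-rowSum a b v i = cong (π b xor_) (sum-translate (inv i) (λ g → π (v g)))

  Cσ-parity : ∀ v₁ v₂ γ₁ γ₂ γ₃ γ₄ → SelfDual (genCσ v₁ v₂ γ₁ γ₂ γ₃ γ₄) → (i : Fin p) →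
              true xor ((π γ₂ xor ε̄ v₁) xor (π γ₄ xor ε̄ v₂)) ≡ false
  Cσ-parity v₁ v₂ γ₁ γ₂ γ₃ γ₄ selfDual i = begin
    true xor ((π γ₂ xor ε̄ v₁) xor (π γ₄ xor ε̄ v₂))
      ≡⟨ sym (cong (true xor_) (cong₂ _xor_ (bordered-rowSum γ₁ γ₂ v₁ i)
                                             (bordered-rowSum γ₃ γ₄ v₂ i))) ⟩
    true xor (rowSum A (suc i) xor rowSum B (suc i))
      ≡⟨ sym (cong (true xor_) (block-rowSum A B (suc i))) ⟩
    true xor rowSum (block A B) (suc i ↑ˡ suc p)
      ≡⟨ sym (augment-rowSum (block A B) (suc i ↑ˡ suc p)) ⟩
    rowSum (genCσ v₁ v₂ γ₁ γ₂ γ₃ γ₄) (suc i ↑ˡ suc p)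
      ≡⟨ selfDual-rowSum (genCσ v₁ v₂ γ₁ γ₂ γ₃ γ₄) selfDual (suc i ↑ˡ suc p) ⟩
    false ∎
    where
    A = bordered γ₁ γ₂ v₁
    B = bordered γ₃ γ₄ v₂

-- The three relations over 𝔽₂ are inconsistent: they would give 1 + (1 + 1) = 0.
parity-clash : ∀ a b c d → c xor d ≡ true → a xor b ≡ true →
               true xor ((c xor a) xor (d xor b)) ≢ false
parity-clash a b c d c+d≡1 a+b≡1 rewrite interchange c a d b | c+d≡1 | a+b≡1 = λ ()

mainTheorem2 : (k p : ℕ) (G : FinGroup p) → p % 2 ≡ 1 →
    (v₁ v₂ : RG k p) (γ₁ γ₂ γ₃ γ₄ : R k) →
    IsUnitR (γ₂ +R γ₄) →
    SelfDual (GroupRing.genCσ G v₁ v₂ γ₁ γ₂ γ₃ γ₄) →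
    ¬ GroupRing.IsUnitRG G
        (GroupRing.addRG G (GroupRing.mulRG G (GroupRing.star G v₁) v₁)
                           (GroupRing.mulRG G (GroupRing.star G v₂) v₂))
mainTheorem2 k p G _ v₁ v₂ γ₁ γ₂ γ₃ γ₄ γ-unit selfDual x-unit =
  parity-clash (ε̄ G v₁) (ε̄ G v₂) (π γ₂) (π γ₄) γ-residue x-residue
    (Cσ-parity G v₁ v₂ γ₁ γ₂ γ₃ γ₄ selfDual (FinGroup.e G))
  where
  open GroupRing {k} {p} G
  γ-residue : π γ₂ xor π γ₄ ≡ true
  γ-residue = trans (sym (π-+ γ₂ γ₄)) (π-unit γ-unit)
  x-residue : ε̄ G v₁ xor ε̄ G v₂ ≡ true
  x-residue = begin
    ε̄ G v₁ xor ε̄ G v₂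
      ≡⟨ sym (cong₂ _xor_ (ε̄-norm G v₁) (ε̄-norm G v₂)) ⟩
    ε̄ G (mulRG (star v₁) v₁) xor ε̄ G (mulRG (star v₂) v₂)
      ≡⟨ sym (ε̄-add G (mulRG (star v₁) v₁) (mulRG (star v₂) v₂)) ⟩
    ε̄ G (addRG (mulRG (star v₁) v₁) (mulRG (star v₂) v₂))
      ≡⟨ ε̄-unit G x-unit ⟩
    true ∎
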